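{- Let $\alpha,\beta,s$ be positive integers with $\alpha<2^s$, and let $n=\alpha+\beta\cdot2^{s+2}$. Then \[ |H_8^{\nabla n}|=|H_8^{\nabla\alpha}|\cdot|H_8^{\nabla\beta}|. \]
   Context: For nonempty finite sets $C=\{c_1,\ldots,c_s\}$, $D$ of positive integers, $C\mathbin{\nabla}D=c_1D\mathbin{\triangle}\cdots\mathbin{\triangle}c_sD$, where $c_iD=\{c_id:d\in D\}$ and $\triangle$ is symmetric difference (equivalently, the set of $m$ for which the number of pairs $(c,d)\in C\times D$ with $cd=m$ is odd). Let $H_8=\{1,2,\ldots,8\}$, $H_8^{\nabla0}=\{1\}$ and $H_8^{\nabla m}=H_8^{\nabla(m-1)}\mathbin{\nabla}H_8$ for $m\geq1$. -}

module Defs where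

open import Data.Nat using (ℕ; zero; suc; _*_; _≟_)
open import Data.Bool using (Bool; true; false; if_then_else_; not)
open import Data.List using (List; []; _∷_; map; concatMap; filter; length; upTo; deduplicate)
open import Relation.Nullary.Decidable using (does)

-- A finite set of positive integers is represented by a list of its
-- elements (duplicates allowed in intermediate lists; the nabla product
-- below always produces a duplicate-free list).

oddCount : ℕ → List ℕ → Bool
oddCount m [] = false
oddCount m (x ∷ xs) = if does (m ≟ x) then not (oddCount m xs) else oddCount m xs

products : List ℕ → List ℕ → List ℕ
products C D = concatMap (λ c → map (λ d → c * d) D) C

_∇_ : List ℕ → List ℕ → List ℕ
C ∇ D = filter (λ m → oddCount m ps Data.Bool.≟ true) (deduplicate _≟_ ps)
  where ps = products C D

H8 : List ℕ
H8 = map suc (upTo 8)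

H8pow : ℕ → List ℕ
H8pow zero = 1 ∷ []
H8pow (suc m) = H8pow m ∇ H8

card : ℕ → ℕ
card m = length (H8pow m)

-- Under ∇, lists of positive integers form the group algebra 𝔽₂[ℕ⁺], in which
-- H₈^{∇m} is the m-th power of H₈.  This algebra is commutative of
-- characteristic 2, so squaring is additive and H₈^{∇ β·2ᴷ} is the image of
-- H₈^{∇β} under x ↦ x^(2ᴷ); hence H₈^{∇n} = H₈^{∇α} ∇ {bᴺ : b ∈ H₈^{∇β}} with
-- N = 2^(s+2).  Every element of H₈^{∇m} is 2ⁱ3ʲ5ᵏ7ˡ with exponents at most 3m,
-- and 3α < N, so by unique factorisation the products a·bᴺ are pairwise
-- distinct: nothing cancels and the cardinality is multiplicative.
module Submission where

open import Defs
open import Algebra.Bundles using (CommutativeRing)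
open import Data.Bool using (Bool; true; false; not; _∧_; _xor_)
import Data.Bool as Bool
open import Data.Bool.Properties
  using (xor-∧-commutativeRing; xor-assoc; xor-same; xor-identityʳ; ∧-distribʳ-xor; ⇔→≡)
open import Data.Empty using (⊥-elim)
open import Data.List using (List; []; _∷_; _++_; map; filter; length; deduplicate; cartesianProductWith)
open import Data.List.Properties using (length-++; length-map; map-cong; map-∘; map-id)
open import Data.List.Membership.Propositional using (_∈_)
open import Data.List.Membership.Propositional.Properties
  using (∈-map⁻; ∈-filter⁺; ∈-filter⁻; ∈-deduplicate⁺; ∈-++⁺ˡ; ∈-++⁺ʳ; ∈-cartesianProductWith⁻)
open import Data.List.Membership.Propositional.Properties.WithK using (unique∧set⇒bag)
open import Data.List.Relation.Binary.BagAndSetEquality using (∼bag⇒↭)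
open import Data.List.Relation.Binary.Disjoint.Propositional using (Disjoint)
open import Data.List.Relation.Binary.Permutation.Propositional.Properties using (↭-length)
open import Data.List.Relation.Unary.All as All using (All; []; _∷_)
open import Data.List.Relation.Unary.All.Properties as All using ()
open import Data.List.Relation.Unary.AllPairs using ([]; _∷_)
open import Data.List.Relation.Unary.Any as Any using (Any; here; there)
open import Data.List.Relation.Unary.Unique.Propositional using (Unique)
open import Data.List.Relation.Unary.Unique.Propositional.Properties using (++⁺; filter⁺; map⁺)
open import Data.Nat using (ℕ; zero; suc; _+_; _*_; _^_; _<_; _≤_; _≟_; _≤?_; z≤n; NonZero)
open import Data.List.Relation.Unary.Unique.DecPropositional.Properties _≟_ using (deduplicate-!)
open import Data.Nat.Divisibility using (_∣_; _∣?_; ∣1⇒≡1; m∣m*n; ∣m⇒∣m*n)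
open import Data.Nat.DivMod using (_%_; [m+kn]%n≡m%n; m<n⇒m%n≡m)
open import Data.Nat.Primality using (Prime; prime?; euclidsLemma; prime[2]; ¬prime[1])
open import Data.Nat.Properties
open import Data.Nat.Tactic.RingSolver using (solve-∀)
open import Data.Product using (∃₂; _×_; _,_; proj₁; proj₂)
open import Data.Sum using (inj₁; inj₂)
open import Function using (_∘_; _⇔_; mk⇔; Equivalence)
open import Level using (0ℓ)
open import Relation.Binary using (IsEquivalence; Setoid; tri<; tri≈; tri>)
import Relation.Binary.Reasoning.Setoid
open import Relation.Binary.PropositionalEquality
open import Relation.Nullary using (¬_; Dec; does; yes; no)
open import Relation.Nullary.Decidable using (True; toWitness; from-yes; from-no; dec-true; dec-false)

open import Algebra.Properties.CommutativeSemigroup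
  (CommutativeRing.+-commutativeSemigroup xor-∧-commutativeRing) using (interchange)

private
  variable
    A B : Set
    xs ys : List A
    C C′ D D′ : List ℕ

xorSum : List A → (A → Bool) → Bool
xorSum []       g = false
xorSum (x ∷ xs) g = g x xor xorSum xs g

xorSum-cong : ∀ (xs : List A) {f g} → (∀ {x} → x ∈ xs → f x ≡ g x) → xorSum xs f ≡ xorSum xs g
xorSum-cong []       _   = refl
xorSum-cong (x ∷ xs) f≡g = cong₂ _xor_ (f≡g (here refl)) (xorSum-cong xs (f≡g ∘ there))

xorSum-vanishing : ∀ (xs : List A) {g} → (∀ {x} → x ∈ xs → g x ≡ false) → xorSum xs g ≡ false
xorSum-vanishing []       _     = refl
xorSum-vanishing (x ∷ xs) g≡false =
  cong₂ _xor_ (g≡false (here refl)) (xorSum-vanishing xs (g≡false ∘ there))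

xorSum-xor : ∀ (xs : List A) f g → xorSum xs (λ x → f x xor g x) ≡ xorSum xs f xor xorSum xs g
xorSum-xor []       f g = refl
xorSum-xor (x ∷ xs) f g =
  trans (cong ((f x xor g x) xor_) (xorSum-xor xs f g)) (interchange (f x) (g x) _ _)

xorSum-++ : ∀ (xs : List A) ys g → xorSum (xs ++ ys) g ≡ xorSum xs g xor xorSum ys g
xorSum-++ []       ys g = refl
xorSum-++ (x ∷ xs) ys g = trans (cong (g x xor_) (xorSum-++ xs ys g)) (sym (xor-assoc (g x) _ _))

xorSum-map : ∀ (f : A → B) xs g → xorSum (map f xs) g ≡ xorSum xs (g ∘ f)
xorSum-map f []       g = refl
xorSum-map f (x ∷ xs) g = cong (g (f x) xor_) (xorSum-map f xs g)

xorSum-∧ʳ : ∀ (xs : List A) f c → xorSum xs f ∧ c ≡ xorSum xs (λ x → f x ∧ c)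
xorSum-∧ʳ []       f c = refl
xorSum-∧ʳ (x ∷ xs) f c = trans (∧-distribʳ-xor c (f x) _) (cong (f x ∧ c xor_) (xorSum-∧ʳ xs f c))

xorSum-swap : ∀ (xs : List A) (ys : List B) (f : A → B → Bool) →
              xorSum xs (λ x → xorSum ys (f x)) ≡ xorSum ys (λ y → xorSum xs (λ x → f x y))
xorSum-swap []       ys f = sym (xorSum-vanishing ys (λ _ → refl))
xorSum-swap (x ∷ xs) ys f =
  trans (cong (xorSum ys (f x) xor_) (xorSum-swap xs ys f)) (sym (xorSum-xor ys (f x) _))

-- Off-diagonal terms of a symmetric double sum cancel in pairs.
xorSum-diagonal : ∀ (xs : List A) (f : A → A → Bool) → (∀ x y → f x y ≡ f y x) →
                  xorSum xs (λ x → xorSum xs (f x)) ≡ xorSum xs (λ x → f x x)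
xorSum-diagonal []       f sym-f = refl
xorSum-diagonal (y ∷ xs) f sym-f = begin
    (f y y xor S) xor xorSum xs (λ x → f x y xor xorSum xs (f x))
  ≡⟨ cong ((f y y xor S) xor_) (xorSum-xor xs (λ x → f x y) (λ x → xorSum xs (f x))) ⟩
    (f y y xor S) xor (xorSum xs (λ x → f x y) xor T)
  ≡⟨ cong (λ s → (f y y xor S) xor (s xor T)) (xorSum-cong xs (λ {x} _ → sym-f x y)) ⟩
    (f y y xor S) xor (S xor T)
  ≡⟨ xor-cancel-middle (f y y) S T ⟩
    f y y xor T
  ≡⟨ cong (f y y xor_) (xorSum-diagonal xs f sym-f) ⟩
    f y y xor xorSum xs (λ x → f x x)
  ∎
  where
  open ≡-Reasoning
  S T : Bool
  S = xorSum xs (f y)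
  T = xorSum xs (λ x → xorSum xs (f x))
  xor-cancel-middle : ∀ a b c → (a xor b) xor (b xor c) ≡ a xor c
  xor-cancel-middle a b c = begin
    (a xor b) xor (b xor c) ≡⟨ xor-assoc a b _ ⟩
    a xor (b xor (b xor c)) ≡⟨ cong (a xor_) (sym (xor-assoc b b c)) ⟩
    a xor ((b xor b) xor c) ≡⟨ cong (λ t → a xor (t xor c)) (xor-same b) ⟩
    a xor c                 ∎

oddCount-xorSum : ∀ m xs → oddCount m xs ≡ xorSum xs (λ x → does (m ≟ x))
oddCount-xorSum m []       = refl
oddCount-xorSum m (x ∷ xs) with does (m ≟ x)
... | true  = cong not (oddCount-xorSum m xs)
... | false = oddCount-xorSum m xs

xorSum≡true⇒Any : ∀ (xs : List A) {g} → xorSum xs g ≡ true → Any (λ x → g x ≡ true) xs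
xorSum≡true⇒Any (x ∷ xs) {g} odd with g x in gx
... | true  = here gx
... | false = there (xorSum≡true⇒Any xs odd)

does-sound : ∀ {P : Set} (p? : Dec P) → does p? ≡ true → P
does-sound (yes p) _ = p

oddCount⇒∈ : ∀ {m} xs → oddCount m xs ≡ true → m ∈ xs
oddCount⇒∈ {m} xs odd =
  Any.map (does-sound (m ≟ _)) (xorSum≡true⇒Any xs (trans (sym (oddCount-xorSum m xs)) odd))

∈⇒oddCount≡true : ∀ {m xs} → Unique xs → m ∈ xs → oddCount m xs ≡ true
∈⇒oddCount≡true {m} {xs} xs-unique m∈xs = trans (oddCount-xorSum m xs) (indicator-sum xs-unique m∈xs)
  where
  indicator-sum : ∀ {xs} → Unique xs → m ∈ xs → xorSum xs (λ x → does (m ≟ x)) ≡ true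
  indicator-sum {m ∷ xs} (m∉xs ∷ _) (here refl) = cong₂ _xor_ (dec-true (m ≟ m) refl)
    (xorSum-vanishing xs (λ m′∈xs → dec-false (m ≟ _) (All.lookup m∉xs m′∈xs)))
  indicator-sum {x ∷ xs} (x∉xs ∷ u) (there m∈xs) = cong₂ _xor_
    (dec-false (m ≟ x) (λ { refl → All.lookup x∉xs m∈xs refl })) (indicator-sum u m∈xs)

≟-∧-swap : ∀ x y (g : ℕ → Bool) → does (x ≟ y) ∧ g x ≡ does (y ≟ x) ∧ g y
≟-∧-swap x y g with x ≟ y
... | yes refl = refl
... | no x≢y   = trans (cong (_∧ g x) (dec-false (x ≟ y) x≢y))
                       (cong (_∧ g y) (sym (dec-false (y ≟ x) (x≢y ∘ sym))))

xorSum-by-oddCount : ∀ {U} xs g → Unique U → (∀ {x} → x ∈ xs → x ∈ U) →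
                     xorSum xs g ≡ xorSum U (λ x → oddCount x xs ∧ g x)
xorSum-by-oddCount {U} xs g U-unique xs⊆U = sym (begin
    xorSum U (λ x → oddCount x xs ∧ g x)
  ≡⟨ xorSum-cong U (λ {x} _ → trans (cong (_∧ g x) (oddCount-xorSum x xs))
                                     (xorSum-∧ʳ xs (λ y → does (x ≟ y)) (g x))) ⟩
    xorSum U (λ x → xorSum xs (λ y → does (x ≟ y) ∧ g x))
  ≡⟨ xorSum-swap U xs (λ x y → does (x ≟ y) ∧ g x) ⟩
    xorSum xs (λ y → xorSum U (λ x → does (x ≟ y) ∧ g x))
  ≡⟨ xorSum-cong xs (λ {y} _ → xorSum-cong U (λ {x} _ → ≟-∧-swap x y g)) ⟩
    xorSum xs (λ y → xorSum U (λ x → does (y ≟ x) ∧ g y))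
  ≡⟨ xorSum-cong xs (λ {y} _ → sym (trans (cong (_∧ g y) (oddCount-xorSum y U))
                                          (xorSum-∧ʳ U (λ x → does (y ≟ x)) (g y)))) ⟩
    xorSum xs (λ y → oddCount y U ∧ g y)
  ≡⟨ xorSum-cong xs (λ {y} y∈xs → cong (_∧ g y) (∈⇒oddCount≡true U-unique (xs⊆U y∈xs))) ⟩
    xorSum xs g
  ∎)
  where open ≡-Reasoning

-- Lists of positive integers model elements of the group algebra 𝔽₂[ℕ⁺]
-- (multiplicities taken mod 2); two lists are identified when every
-- 𝔽₂-valued functional takes the same value on them.
infix 4 _≈₂_
record _≈₂_ (xs ys : List ℕ) : Set where
  constructor mk≈₂
  field xorSum-≡ : ∀ g → xorSum xs g ≡ xorSum ys g
open _≈₂_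

≈₂-isEquivalence : IsEquivalence _≈₂_
≈₂-isEquivalence = record
  { refl  = mk≈₂ λ _ → refl
  ; sym   = λ p → mk≈₂ λ g → sym (xorSum-≡ p g)
  ; trans = λ p q → mk≈₂ λ g → trans (xorSum-≡ p g) (xorSum-≡ q g)
  }

≈₂-setoid : Setoid 0ℓ 0ℓ
≈₂-setoid = record { isEquivalence = ≈₂-isEquivalence }

open IsEquivalence ≈₂-isEquivalence using ()
  renaming (refl to ≈₂-refl; sym to ≈₂-sym; reflexive to ≈₂-reflexive)
module ≈₂-Reasoning = Relation.Binary.Reasoning.Setoid ≈₂-setoid

≈₂⇒oddCount-≡ : xs ≈₂ ys → ∀ m → oddCount m xs ≡ oddCount m ys
≈₂⇒oddCount-≡ {xs = xs} {ys} xs≈ys m = begin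
  oddCount m xs                      ≡⟨ oddCount-xorSum m xs ⟩
  xorSum xs (λ x → does (m ≟ x))     ≡⟨ xorSum-≡ xs≈ys _ ⟩
  xorSum ys (λ x → does (m ≟ x))     ≡⟨ oddCount-xorSum m ys ⟨
  oddCount m ys                      ∎
  where open ≡-Reasoning

oddCount-≡⇒≈₂ : (∀ m → oddCount m xs ≡ oddCount m ys) → xs ≈₂ ys
oddCount-≡⇒≈₂ {xs = xs} {ys} same-parity = mk≈₂ λ g → begin
  xorSum xs g                            ≡⟨ xorSum-by-oddCount xs g U-unique (∈-deduplicate⁺ _≟_ ∘ ∈-++⁺ˡ) ⟩
  xorSum U (λ x → oddCount x xs ∧ g x)   ≡⟨ xorSum-cong U (λ {x} _ → cong (_∧ g x) (same-parity x)) ⟩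
  xorSum U (λ x → oddCount x ys ∧ g x)   ≡⟨ xorSum-by-oddCount ys g U-unique
                                                                (∈-deduplicate⁺ _≟_ ∘ ∈-++⁺ʳ xs) ⟨
  xorSum ys g                            ∎
  where
  open ≡-Reasoning
  U : List ℕ
  U = deduplicate _≟_ (xs ++ ys)
  U-unique : Unique U
  U-unique = deduplicate-! (xs ++ ys)

unique-≈₂⇒length-≡ : Unique xs → Unique ys → xs ≈₂ ys → length xs ≡ length ys
unique-≈₂⇒length-≡ {xs = xs} {ys} xs-unique ys-unique xs≈ys =
  ↭-length (∼bag⇒↭ (unique∧set⇒bag xs-unique ys-unique (mk⇔ ∈xs⇒∈ys ∈ys⇒∈xs)))
  where
  ∈xs⇒∈ys : ∀ {m} → m ∈ xs → m ∈ ys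
  ∈xs⇒∈ys {m} m∈xs = oddCount⇒∈ ys (trans (sym (≈₂⇒oddCount-≡ xs≈ys m)) (∈⇒oddCount≡true xs-unique m∈xs))
  ∈ys⇒∈xs : ∀ {m} → m ∈ ys → m ∈ xs
  ∈ys⇒∈xs {m} m∈ys = oddCount⇒∈ xs (trans (≈₂⇒oddCount-≡ xs≈ys m) (∈⇒oddCount≡true ys-unique m∈ys))

products≡cartesianProductWith : ∀ C D → products C D ≡ cartesianProductWith _*_ C D
products≡cartesianProductWith []      D = refl
products≡cartesianProductWith (c ∷ C) D = cong (map (c *_) D ++_) (products≡cartesianProductWith C D)

∈-products⁻ : ∀ C D {v} → v ∈ products C D → ∃₂ λ c d → c ∈ C × d ∈ D × v ≡ c * d
∈-products⁻ C D v∈ = ∈-cartesianProductWith⁻ _*_ C D (subst (_ ∈_) (products≡cartesianProductWith C D) v∈)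

length-products : ∀ C D → length (products C D) ≡ length C * length D
length-products []      D = refl
length-products (c ∷ C) D =
  trans (length-++ (map (c *_) D)) (cong₂ _+_ (length-map (c *_) D) (length-products C D))

map-unique : ∀ {f : A → B} → (∀ {x y} → x ∈ xs → y ∈ xs → f x ≡ f y → x ≡ y) →
             Unique xs → Unique (map f xs)
map-unique {xs = []}     _     []           = []
map-unique {xs = x ∷ xs} f-inj (x∉xs ∷ xs!) =
  All.map⁺ (All.tabulate λ y∈xs fx≡fy → All.lookup x∉xs y∈xs (f-inj (here refl) (there y∈xs) fx≡fy))
  ∷ map-unique (λ x∈ y∈ → f-inj (there x∈) (there y∈)) xs!

products-unique : Unique C → Unique D →
                  (∀ {c c′ d d′} → c ∈ C → c′ ∈ C → d ∈ D → d′ ∈ D → c * d ≡ c′ * d′ → c ≡ c′ × d ≡ d′) →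
                  Unique (products C D)
products-unique {[]}    _            _  _     = []
products-unique {c ∷ C} {D} (c∉C ∷ C!) D! *-inj =
  ++⁺ (map-unique (λ d∈ d′∈ → proj₂ ∘ *-inj (here refl) (here refl) d∈ d′∈) D!)
      (products-unique C! D! (λ c∈ c′∈ → *-inj (there c∈) (there c′∈)))
      disjoint
  where
  disjoint : Disjoint (map (c *_) D) (products C D)
  disjoint (v∈cD , v∈CD)
    with d , d∈D , refl ← ∈-map⁻ (c *_) v∈cD
    with c′ , d′ , c′∈C , d′∈D , cd≡c′d′ ← ∈-products⁻ C D v∈CD
    = All.lookup c∉C c′∈C (proj₁ (*-inj (here refl) (there c′∈C) d∈D d′∈D cd≡c′d′))

xorSum-products : ∀ C D g → xorSum (products C D) g ≡ xorSum C (λ c → xorSum D (λ d → g (c * d)))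
xorSum-products []      D g = refl
xorSum-products (c ∷ C) D g = trans (xorSum-++ (map (c *_) D) (products C D) g)
  (cong₂ _xor_ (xorSum-map (c *_) D g) (xorSum-products C D g))

oddIn? : ∀ C D m → Dec (oddCount m (products C D) ≡ true)
oddIn? C D m = oddCount m (products C D) Bool.≟ true

∇-unique : ∀ C D → Unique (C ∇ D)
∇-unique C D = filter⁺ (oddIn? C D) (deduplicate-! (products C D))

∈-∇⇔odd : ∀ C D {v} → v ∈ C ∇ D ⇔ oddCount v (products C D) ≡ true
∈-∇⇔odd C D = mk⇔ (proj₂ ∘ ∈-filter⁻ (oddIn? C D) {xs = deduplicate _≟_ (products C D)})
                  (λ odd → ∈-filter⁺ (oddIn? C D) (∈-deduplicate⁺ _≟_ (oddCount⇒∈ (products C D) odd)) odd)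

∇≈₂products : ∀ C D → C ∇ D ≈₂ products C D
∇≈₂products C D = oddCount-≡⇒≈₂ λ m → ⇔→≡ (mk⇔
  (Equivalence.to (∈-∇⇔odd C D) ∘ oddCount⇒∈ (C ∇ D))
  (∈⇒oddCount≡true (∇-unique C D) ∘ Equivalence.from (∈-∇⇔odd C D)))

∈-∇⁻ : ∀ C D {v} → v ∈ C ∇ D → ∃₂ λ c d → c ∈ C × d ∈ D × v ≡ c * d
∈-∇⁻ C D = ∈-products⁻ C D ∘ oddCount⇒∈ (products C D) ∘ Equivalence.to (∈-∇⇔odd C D)

products-cong : C ≈₂ C′ → D ≈₂ D′ → products C D ≈₂ products C′ D′
products-cong {C} {C′} {D} {D′} C≈C′ D≈D′ = mk≈₂ λ g → begin
  xorSum (products C D) g                          ≡⟨ xorSum-products C D g ⟩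
  xorSum C (λ c → xorSum D (λ d → g (c * d)))      ≡⟨ xorSum-≡ C≈C′ _ ⟩
  xorSum C′ (λ c → xorSum D (λ d → g (c * d)))     ≡⟨ xorSum-cong C′ (λ _ → xorSum-≡ D≈D′ _) ⟩
  xorSum C′ (λ c → xorSum D′ (λ d → g (c * d)))    ≡⟨ xorSum-products C′ D′ g ⟨
  xorSum (products C′ D′) g                        ∎
  where open ≡-Reasoning

map-cong-≈₂ : ∀ (f : ℕ → ℕ) → C ≈₂ C′ → map f C ≈₂ map f C′
map-cong-≈₂ {C} {C′} f C≈C′ = mk≈₂ λ g →
  trans (xorSum-map f C g) (trans (xorSum-≡ C≈C′ (g ∘ f)) (sym (xorSum-map f C′ g)))

products-assoc : ∀ C D E → products (products C D) E ≈₂ products C (products D E)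
products-assoc C D E = mk≈₂ λ g → begin
  xorSum (products (products C D) E) g
    ≡⟨ xorSum-products (products C D) E g ⟩
  xorSum (products C D) (λ x → xorSum E (λ e → g (x * e)))
    ≡⟨ xorSum-products C D _ ⟩
  xorSum C (λ c → xorSum D (λ d → xorSum E (λ e → g (c * d * e))))
    ≡⟨ xorSum-cong C (λ {c} _ → xorSum-cong D (λ {d} _ → xorSum-cong E (λ {e} _ → cong g (*-assoc c d e)))) ⟩
  xorSum C (λ c → xorSum D (λ d → xorSum E (λ e → g (c * (d * e)))))
    ≡⟨ xorSum-cong C (λ {c} _ → xorSum-products D E (λ y → g (c * y))) ⟨
  xorSum C (λ c → xorSum (products D E) (λ y → g (c * y)))
    ≡⟨ xorSum-products C (products D E) g ⟨
  xorSum (products C (products D E)) g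
    ∎
  where open ≡-Reasoning

products-identityʳ : ∀ C → products C (1 ∷ []) ≈₂ C
products-identityʳ C = mk≈₂ λ g → trans (xorSum-products C (1 ∷ []) g)
  (xorSum-cong C (λ {c} _ → trans (xor-identityʳ (g (c * 1))) (cong g (*-identityʳ c))))

products-self : ∀ C → products C C ≈₂ map (λ x → x * x) C
products-self C = mk≈₂ λ g → begin
  xorSum (products C C) g
    ≡⟨ xorSum-products C C g ⟩
  xorSum C (λ c → xorSum C (λ d → g (c * d)))
    ≡⟨ xorSum-diagonal C (λ c d → g (c * d)) (λ c d → cong g (*-comm c d)) ⟩
  xorSum C (λ c → g (c * c))
    ≡⟨ xorSum-map (λ x → x * x) C g ⟨
  xorSum (map (λ x → x * x) C) g
    ∎
  where open ≡-Reasoning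

H8pow-unique : ∀ m → Unique (H8pow m)
H8pow-unique zero    = [] ∷ []
H8pow-unique (suc m) = ∇-unique (H8pow m) H8

H8pow-+ : ∀ a b → H8pow (a + b) ≈₂ products (H8pow a) (H8pow b)
H8pow-+ a zero rewrite +-identityʳ a = ≈₂-sym (products-identityʳ (H8pow a))
H8pow-+ a (suc b) rewrite +-suc a b = begin
  H8pow (a + b) ∇ H8                              ≈⟨ ∇≈₂products (H8pow (a + b)) H8 ⟩
  products (H8pow (a + b)) H8                     ≈⟨ products-cong (H8pow-+ a b) ≈₂-refl ⟩
  products (products (H8pow a) (H8pow b)) H8      ≈⟨ products-assoc (H8pow a) (H8pow b) H8 ⟩
  products (H8pow a) (products (H8pow b) H8)      ≈⟨ products-cong (≈₂-refl {H8pow a}) (∇≈₂products (H8pow b) H8) ⟨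
  products (H8pow a) (H8pow (suc b))              ∎
  where open ≈₂-Reasoning

H8pow-*2^ : ∀ β K → H8pow (β * 2 ^ K) ≈₂ map (_^ 2 ^ K) (H8pow β)
H8pow-*2^ β zero rewrite *-identityʳ β =
  ≈₂-reflexive (sym (trans (map-cong ^-identityʳ (H8pow β)) (map-id (H8pow β))))
H8pow-*2^ β (suc K) = begin
  H8pow (β * (2 * M))                           ≡⟨ cong H8pow (double β M) ⟩
  H8pow (n + n)                                 ≈⟨ H8pow-+ n n ⟩
  products (H8pow n) (H8pow n)                  ≈⟨ products-self (H8pow n) ⟩
  map (λ x → x * x) (H8pow n)                   ≈⟨ map-cong-≈₂ (λ x → x * x) (H8pow-*2^ β K) ⟩
  map (λ x → x * x) (map (_^ M) (H8pow β))      ≡⟨ map-∘ (H8pow β) ⟨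
  map (λ x → x ^ M * x ^ M) (H8pow β)           ≡⟨ map-cong (λ x → sym (^-double x M)) (H8pow β) ⟩
  map (_^ (2 * M)) (H8pow β)                    ∎
  where
  open ≈₂-Reasoning
  M n : ℕ
  M = 2 ^ K
  n = β * M
  double : ∀ b m → b * (2 * m) ≡ b * m + b * m
  double = solve-∀
  ^-double : ∀ x m → x ^ (2 * m) ≡ x ^ m * x ^ m
  ^-double x m = trans (cong (x ^_) (cong (m +_) (+-identityʳ m))) (^-distribˡ-+-* x m m)

H8pow-+-*2^ : ∀ α β K → H8pow (α + β * 2 ^ K) ≈₂ products (H8pow α) (map (_^ 2 ^ K) (H8pow β))
H8pow-+-*2^ α β K = begin
  H8pow (α + β * 2 ^ K)                               ≈⟨ H8pow-+ α (β * 2 ^ K) ⟩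
  products (H8pow α) (H8pow (β * 2 ^ K))              ≈⟨ products-cong (≈₂-refl {H8pow α}) (H8pow-*2^ β K) ⟩
  products (H8pow α) (map (_^ 2 ^ K) (H8pow β))       ∎
  where open ≈₂-Reasoning

smooth : ℕ → ℕ → ℕ → ℕ → ℕ
smooth i j k l = 2 ^ i * (3 ^ j * (5 ^ k * 7 ^ l))

smooth-* : ∀ i j k l i′ j′ k′ l′ →
           smooth i j k l * smooth i′ j′ k′ l′ ≡ smooth (i + i′) (j + j′) (k + k′) (l + l′)
smooth-* i j k l i′ j′ k′ l′
  rewrite ^-distribˡ-+-* 2 i i′ | ^-distribˡ-+-* 3 j j′ | ^-distribˡ-+-* 5 k k′ | ^-distribˡ-+-* 7 l l′
  = interchange₄ (2 ^ i) (3 ^ j) (5 ^ k) (7 ^ l) (2 ^ i′) (3 ^ j′) (5 ^ k′) (7 ^ l′)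
  where
  interchange₄ : ∀ a b c d a′ b′ c′ d′ →
    (a * (b * (c * d))) * (a′ * (b′ * (c′ * d′))) ≡ (a * a′) * ((b * b′) * ((c * c′) * (d * d′)))
  interchange₄ = solve-∀

smooth-^ : ∀ i j k l n → smooth i j k l ^ n ≡ smooth (n * i) (n * j) (n * k) (n * l)
smooth-^ i j k l zero    = refl
smooth-^ i j k l (suc n) =
  trans (cong (smooth i j k l *_) (smooth-^ i j k l n)) (smooth-* i j k l (n * i) (n * j) (n * k) (n * l))

prime∤* : ∀ {p m n} → Prime p → ¬ p ∣ m → ¬ p ∣ n → ¬ p ∣ m * n
prime∤* {m = m} {n} p-prime p∤m p∤n p∣mn with euclidsLemma m n p-prime p∣mn
... | inj₁ p∣m = p∤m p∣m
... | inj₂ p∣n = p∤n p∣n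

prime∤^ : ∀ {p m} → Prime p → ¬ p ∣ m → ∀ k → ¬ p ∣ m ^ k
prime∤^ p-prime p∤m zero    p∣1 = ¬prime[1] (subst Prime (∣1⇒≡1 p∣1) p-prime)
prime∤^ p-prime p∤m (suc k)     = prime∤* p-prime p∤m (prime∤^ p-prime p∤m k)

^-*-unique : ∀ p .{{_ : NonZero p}} {i j u v} → ¬ p ∣ u → ¬ p ∣ v →
             p ^ i * u ≡ p ^ j * v → i ≡ j × u ≡ v
^-*-unique p {zero}  {zero}  {u} {v} _ _ eq = refl , trans (sym (*-identityˡ u)) (trans eq (*-identityˡ v))
^-*-unique p {suc i} {zero}  {u} {v} _ p∤v eq =
  ⊥-elim (p∤v (subst (p ∣_) (trans eq (*-identityˡ v)) (∣m⇒∣m*n u (m∣m*n (p ^ i)))))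
^-*-unique p {zero}  {suc j} {u} {v} p∤u _ eq =
  ⊥-elim (p∤u (subst (p ∣_) (trans (sym eq) (*-identityˡ u)) (∣m⇒∣m*n v (m∣m*n (p ^ j)))))
^-*-unique p {suc i} {suc j} {u} {v} p∤u p∤v eq
  with refl , u≡v ← ^-*-unique p {i} {j} p∤u p∤v
         (*-cancelˡ-≡ (p ^ i * u) (p ^ j * v) p
           (trans (sym (*-assoc p (p ^ i) u)) (trans eq (*-assoc p (p ^ j) v))))
  = refl , u≡v

prime[3] : Prime 3
prime[3] = from-yes (prime? 3)

prime[5] : Prime 5
prime[5] = from-yes (prime? 5)

2∤3^j*5^k*7^l : ∀ j k l → ¬ 2 ∣ 3 ^ j * (5 ^ k * 7 ^ l)
2∤3^j*5^k*7^l j k l = prime∤* prime[2] (prime∤^ prime[2] (from-no (2 ∣? 3)) j)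
  (prime∤* prime[2] (prime∤^ prime[2] (from-no (2 ∣? 5)) k) (prime∤^ prime[2] (from-no (2 ∣? 7)) l))

3∤5^k*7^l : ∀ k l → ¬ 3 ∣ 5 ^ k * 7 ^ l
3∤5^k*7^l k l =
  prime∤* prime[3] (prime∤^ prime[3] (from-no (3 ∣? 5)) k) (prime∤^ prime[3] (from-no (3 ∣? 7)) l)

5∤7^l : ∀ l → ¬ 5 ∣ 7 ^ l
5∤7^l = prime∤^ prime[5] (from-no (5 ∣? 7))

smooth-injective : ∀ {i j k l i′ j′ k′ l′} → smooth i j k l ≡ smooth i′ j′ k′ l′ →
                   i ≡ i′ × j ≡ j′ × k ≡ k′ × l ≡ l′
smooth-injective {i} {j} {k} {l} {i′} {j′} {k′} {l′} eq
  with refl , eq₂ ← ^-*-unique 2 {i} {i′} (2∤3^j*5^k*7^l j k l) (2∤3^j*5^k*7^l j′ k′ l′) eq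
  with refl , eq₃ ← ^-*-unique 3 {j} {j′} (3∤5^k*7^l k l) (3∤5^k*7^l k′ l′) eq₂
  with refl , eq₅ ← ^-*-unique 5 {k} {k′} (5∤7^l l) (5∤7^l l′) eq₃
  with refl , _   ← ^-*-unique 7 {l} {l′} {u = 1} {v = 1} (from-no (7 ∣? 1)) (from-no (7 ∣? 1))
                      (trans (*-identityʳ _) (trans eq₅ (sym (*-identityʳ _))))
  = refl , refl , refl , refl

record Smooth (b x : ℕ) : Set where
  constructor smooth⟨_,_,_,_⟩
  field
    {i j k l} : ℕ
    i≤b : i ≤ b
    j≤b : j ≤ b
    k≤b : k ≤ b
    l≤b : l ≤ b
    x≡  : x ≡ smooth i j k l

Smooth-* : ∀ {b c x y} → Smooth b x → Smooth c y → Smooth (b + c) (x * y)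
Smooth-* (smooth⟨_,_,_,_⟩ {i} {j} {k} {l} i≤b j≤b k≤b l≤b refl)
         (smooth⟨_,_,_,_⟩ {i′} {j′} {k′} {l′} i′≤c j′≤c k′≤c l′≤c refl) =
  smooth⟨ +-mono-≤ i≤b i′≤c , +-mono-≤ j≤b j′≤c , +-mono-≤ k≤b k′≤c , +-mono-≤ l≤b l′≤c ⟩
    (smooth-* i j k l i′ j′ k′ l′)

smooth≤3 : ∀ i j k l {_ : True (i ≤? 3)} {_ : True (j ≤? 3)} {_ : True (k ≤? 3)} {_ : True (l ≤? 3)} →
           Smooth 3 (smooth i j k l)
smooth≤3 i j k l {i≤3} {j≤3} {k≤3} {l≤3} =
  smooth⟨ toWitness i≤3 , toWitness j≤3 , toWitness k≤3 , toWitness l≤3 ⟩ refl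

H8-smooth : All (Smooth 3) H8
H8-smooth = smooth≤3 0 0 0 0 ∷ smooth≤3 1 0 0 0 ∷ smooth≤3 0 1 0 0 ∷ smooth≤3 2 0 0 0
          ∷ smooth≤3 0 0 1 0 ∷ smooth≤3 1 1 0 0 ∷ smooth≤3 0 0 0 1 ∷ smooth≤3 3 0 0 0 ∷ []

H8pow-smooth : ∀ m {x} → x ∈ H8pow m → Smooth (m * 3) x
H8pow-smooth zero    (here refl) = smooth⟨ z≤n , z≤n , z≤n , z≤n ⟩ refl
H8pow-smooth (suc m) x∈
  with c , d , c∈ , d∈ , refl ← ∈-∇⁻ (H8pow m) H8 x∈
  = subst (Smooth _) (*-comm d c) (Smooth-* (All.lookup H8-smooth d∈) (H8pow-smooth m c∈))

+-*-unique : ∀ n .{{_ : NonZero n}} {i j p q} → i < n → j < n → i + n * p ≡ j + n * q → i ≡ j × p ≡ q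
+-*-unique n {i} {j} {p} {q} i<n j<n eq =
  i≡j , *-cancelˡ-≡ p q n (+-cancelˡ-≡ i _ _ (trans eq (cong (_+ n * q) (sym i≡j))))
  where
  remainder : ∀ {r} t → r < n → (r + n * t) % n ≡ r
  remainder {r} t r<n =
    trans (cong (λ s → (r + s) % n) (*-comm n t)) (trans ([m+kn]%n≡m%n r t n) (m<n⇒m%n≡m r<n))
  i≡j : i ≡ j
  i≡j = trans (sym (remainder p i<n)) (trans (cong (_% n) eq) (remainder q j<n))

^-injectiveˡ : ∀ n .{{_ : NonZero n}} {x y} → x ^ n ≡ y ^ n → x ≡ y
^-injectiveˡ n {x} {y} xⁿ≡yⁿ with <-cmp x y
... | tri< x<y _ _ = ⊥-elim (<⇒≢ (^-monoˡ-< n x<y) xⁿ≡yⁿ)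
... | tri≈ _ x≡y _ = x≡y
... | tri> _ _ y<x = ⊥-elim (<⇒≢ (^-monoˡ-< n y<x) (sym xⁿ≡yⁿ))

smooth-*-^ : ∀ N i j k l p q r t →
             smooth i j k l * smooth p q r t ^ N ≡ smooth (i + N * p) (j + N * q) (k + N * r) (l + N * t)
smooth-*-^ N i j k l p q r t =
  trans (cong (smooth i j k l *_) (smooth-^ p q r t N)) (smooth-* i j k l (N * p) (N * q) (N * r) (N * t))

-- With all exponents of a below N, the exponents of a · xᴺ are base-N
-- numerals whose last digit comes from a and the others from x.
*-^-injective : ∀ N .{{_ : NonZero N}} {b c c′ a a′ x x′} → b < N →
                Smooth b a → Smooth b a′ → Smooth c x → Smooth c′ x′ →
                a * x ^ N ≡ a′ * x′ ^ N → a ≡ a′ × x ≡ x′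
*-^-injective N {b} b<N (smooth⟨_,_,_,_⟩ {i} {j} {k} {l} i≤b j≤b k≤b l≤b refl)
                        (smooth⟨_,_,_,_⟩ {i′} {j′} {k′} {l′} i′≤b j′≤b k′≤b l′≤b refl)
                        (smooth⟨_,_,_,_⟩ {p} {q} {r} {t} _ _ _ _ refl)
                        (smooth⟨_,_,_,_⟩ {p′} {q′} {r′} {t′} _ _ _ _ refl) eq
  with eᵢ , eⱼ , eₖ , eₗ ← smooth-injective
      (trans (sym (smooth-*-^ N i j k l p q r t)) (trans eq (smooth-*-^ N i′ j′ k′ l′ p′ q′ r′ t′)))
  with refl , refl ← +-*-unique N {i} {i′} {p} {p′} (≤-<-trans i≤b b<N) (≤-<-trans i′≤b b<N) eᵢ
  with refl , refl ← +-*-unique N {j} {j′} {q} {q′} (≤-<-trans j≤b b<N) (≤-<-trans j′≤b b<N) eⱼ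
  with refl , refl ← +-*-unique N {k} {k′} {r} {r′} (≤-<-trans k≤b b<N) (≤-<-trans k′≤b b<N) eₖ
  with refl , refl ← +-*-unique N {l} {l′} {t} {t′} (≤-<-trans l≤b b<N) (≤-<-trans l′≤b b<N) eₗ
  = refl , refl

products-^-unique : ∀ α β N .{{_ : NonZero N}} → α * 3 < N →
                    Unique (products (H8pow α) (map (_^ N) (H8pow β)))
products-^-unique α β N α*3<N =
  products-unique (H8pow-unique α) (map⁺ (^-injectiveˡ N) (H8pow-unique β)) *-inj
  where
  *-inj : ∀ {a a′ y y′} → a ∈ H8pow α → a′ ∈ H8pow α →
          y ∈ map (_^ N) (H8pow β) → y′ ∈ map (_^ N) (H8pow β) →
          a * y ≡ a′ * y′ → a ≡ a′ × y ≡ y′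
  *-inj a∈ a′∈ y∈ y′∈ eq
    with x , x∈ , refl ← ∈-map⁻ (_^ N) y∈
    with x′ , x′∈ , refl ← ∈-map⁻ (_^ N) y′∈
    with refl , refl ← *-^-injective N α*3<N (H8pow-smooth α a∈) (H8pow-smooth α a′∈)
                         (H8pow-smooth β x∈) (H8pow-smooth β x′∈) eq
    = refl , refl

α*3<2^[s+2] : ∀ {α} s → α < 2 ^ s → α * 3 < 2 ^ (s + 2)
α*3<2^[s+2] {α} s α<2^s = begin-strict
  α * 3          <⟨ *-monoˡ-< 3 α<2^s ⟩
  2 ^ s * 3      ≤⟨ *-monoʳ-≤ (2 ^ s) (n≤1+n 3) ⟩
  2 ^ s * 2 ^ 2  ≡⟨ ^-distribˡ-+-* 2 s 2 ⟨
  2 ^ (s + 2)    ∎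
  where open ≤-Reasoning

lemma9 : (α β s : ℕ) → 0 < α → 0 < β → 0 < s → α < 2 ^ s →
    card (α + β * 2 ^ (s + 2)) ≡ card α * card β
lemma9 α β s _ _ _ α<2^s = begin
  card (α + β * N)                         ≡⟨ unique-≈₂⇒length-≡ (H8pow-unique (α + β * N)) Q-unique
                                                                 (H8pow-+-*2^ α β (s + 2)) ⟩
  length Q                                 ≡⟨ length-products (H8pow α) (map (_^ N) (H8pow β)) ⟩
  card α * length (map (_^ N) (H8pow β))   ≡⟨ cong (card α *_) (length-map (_^ N) (H8pow β)) ⟩
  card α * card β                          ∎
  where
  open ≡-Reasoning
  N : ℕ
  N = 2 ^ (s + 2)
  Q : List ℕ
  Q = products (H8pow α) (map (_^ N) (H8pow β))
  Q-unique : Unique Q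
  Q-unique = products-^-unique α β N {{m^n≢0 2 (s + 2)}} (α*3<2^[s+2] s α<2^s)
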